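{- For each $M\in\{1,2,3,4\}$, the sequence $(C_M^N)_{N\ge 1}$ is semicomplete, where $C_M^N$ denotes the maximum number of pieces into which an $M$-dimensional hypercube can be cut using $N-1$ hyperplanes.
   Context: Equivalently, $C_M^N=\sum_{i=0}^{M}\binom{N-1}{i}$; it satisfies $C_M^1=1$ and $C_M^N=C_M^{N-1}+C_{M-1}^{N-1}$. Explicitly $C_1^N=N$, $C_2^N=\frac{N^2-N+2}{2}$ (lazy caterer's sequence), $C_3^N=\frac{N^3-3N^2+8N}{6}$ (cake numbers), $C_4^N=\frac{N^4-6N^3+23N^2-18N+24}{24}$. A sequence $(n_i)_{i\ge1}$ of integers is called semicomplete if all its terms are positive, it is strictly increasing, and the following holds: for every integer $j>2$, letting $G_j=\frac{n_1}{j}+\cdots+\frac{n_j}{j}$, every positive integer $k<\lfloor G_j\rfloor$ can be written as $k=\frac{a_1}{j}+\cdots+\frac{a_m}{j}$ where $a_1,\ldots,a_m$ are distinct elements of $\{n_1,\ldots,n_j\}$. -}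

module Defs where

open import Data.Nat using (ℕ; zero; suc; _+_; _*_; _∸_; _<_; _≤_; z<s; s<s; >-nonZero)
open import Data.Nat.Properties using (<-trans)
open import Data.Nat.DivMod using (_/_)
open import Data.Nat.Combinatorics using (_C_)
open import Data.List using (List; applyUpTo)
open import Data.Nat.ListAction using (sum)
open import Data.List.Relation.Unary.All using (All)
open import Data.List.Relation.Unary.Unique.Propositional using (Unique)
open import Data.Product using (Σ; ∃; _×_)
open import Relation.Binary.PropositionalEquality using (_≡_)

-- Cuts M N = Σ_{i=0}^{M} binom(N-1, i)   (meaningful for N ≥ 1; sequence indexed from 1)
Cuts : ℕ → ℕ → ℕ
Cuts M N = sum (applyUpTo (λ i → (N ∸ 1) C i) (suc M))

-- Sequences (n_i)_{i ≥ 1} are functions ℕ → ℕ whose value at 0 is ignored.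

partialSum : (ℕ → ℕ) → ℕ → ℕ
partialSum n j = sum (applyUpTo (λ i → n (suc i)) j)

floorG : (ℕ → ℕ) → (j : ℕ) → 2 < j → ℕ
floorG n j j>2 = _/_ (partialSum n j) j {{>-nonZero (<-trans z<s (<-trans (s<s z<s) j>2))}}

Representable : (ℕ → ℕ) → ℕ → ℕ → Set
Representable n j k =
  Σ (List ℕ) λ as →
    Unique as ×
    All (λ a → ∃ λ i → (1 ≤ i) × (i ≤ j) × (a ≡ n i)) as ×
    (k * j ≡ sum as)

Semicomplete : (ℕ → ℕ) → Set
Semicomplete n =
  (∀ i → 1 ≤ i → 0 < n i) ×
  (∀ i → 1 ≤ i → n i < n (suc i)) ×
  (∀ j → (j>2 : 2 < j) → ∀ k → 0 < k → k < floorG n j j>2 → Representable n j k)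

-- A strictly increasing sequence of positive integers satisfying Brown's condition
-- n_{j+1} ≤ 1 + n₁ + ⋯ + n_j is complete in Brown's sense: every t ≤ n₁ + ⋯ + n_j is a
-- sum of distinct terms among n₁, …, n_j (greedily take n_j whenever t exceeds the sum of
-- the earlier terms).  Since ⌊G_j⌋ · j ≤ n₁ + ⋯ + n_j, completeness gives semicompleteness.
-- The numbers C_M^N satisfy Brown's condition because of the recursion
-- C_M^{N+1} = C_M^N + C_{M-1}^N ≤ 2 C_M^N, for every M ≥ 1, not only M ≤ 4.
module Submission where

open import Defs
open import Data.Nat using (ℕ; zero; suc; _+_; _*_; _∸_; _≤_; _<_; z≤n; s≤s; >-nonZero)
open import Data.Nat.Properties
open import Algebra.Properties.CommutativeSemigroup +-commutativeSemigroup using (interchange)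
open import Data.Nat.DivMod using (m/n*n≤m)
open import Data.Nat.Combinatorics using (_C_; nCk+nC[k+1]≡[n+1]C[k+1])
open import Data.Nat.ListAction using (sum)
open import Data.Nat.ListAction.Properties using (sum-++)
open import Data.List using (List; []; _∷_; _∷ʳ_; [_]; applyUpTo)
open import Data.List.Properties using (applyUpTo-∷ʳ)
open import Data.List.Relation.Unary.All as All using (All; []; _∷_)
open import Data.List.Relation.Unary.AllPairs using ([]; _∷_)
open import Data.List.Relation.Unary.Unique.Propositional using (Unique)
open import Data.Product using (Σ; ∃; _×_; _,_)
open import Data.Sum using (inj₁; inj₂)
open import Relation.Nullary using (yes; no)
open import Relation.Binary.PropositionalEquality using (_≡_; refl; sym; trans; cong; cong₂; subst; module ≡-Reasoning)

sum-applyUpTo-suc : ∀ (f : ℕ → ℕ) n →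
  sum (applyUpTo f (suc n)) ≡ sum (applyUpTo f n) + f n
sum-applyUpTo-suc f n = begin
  sum (applyUpTo f (suc n))             ≡⟨ cong sum (applyUpTo-∷ʳ f n) ⟨
  sum (applyUpTo f n ∷ʳ f n)            ≡⟨ sum-++ (applyUpTo f n) [ f n ] ⟩
  sum (applyUpTo f n) + (f n + 0)       ≡⟨ cong (sum (applyUpTo f n) +_) (+-identityʳ (f n)) ⟩
  sum (applyUpTo f n) + f n             ∎
  where open ≡-Reasoning

sum-applyUpTo-cong : ∀ {f g : ℕ → ℕ} → (∀ i → f i ≡ g i) →
  ∀ n → sum (applyUpTo f n) ≡ sum (applyUpTo g n)
sum-applyUpTo-cong f≗g zero = refl
sum-applyUpTo-cong f≗g (suc n) = cong₂ _+_ (f≗g 0) (sum-applyUpTo-cong (λ i → f≗g (suc i)) n)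

sum-applyUpTo-+ : ∀ (f g : ℕ → ℕ) n →
  sum (applyUpTo (λ i → f i + g i) n) ≡ sum (applyUpTo f n) + sum (applyUpTo g n)
sum-applyUpTo-+ f g zero = refl
sum-applyUpTo-+ f g (suc n) = begin
  f 0 + g 0 + sum (applyUpTo (λ i → f (suc i) + g (suc i)) n)
    ≡⟨ cong (f 0 + g 0 +_) (sum-applyUpTo-+ (λ i → f (suc i)) (λ i → g (suc i)) n) ⟩
  f 0 + g 0 + (sum (applyUpTo (λ i → f (suc i)) n) + sum (applyUpTo (λ i → g (suc i)) n))
    ≡⟨ interchange (f 0) (g 0) _ _ ⟩
  f 0 + sum (applyUpTo (λ i → f (suc i)) n) + (g 0 + sum (applyUpTo (λ i → g (suc i)) n)) ∎
  where open ≡-Reasoning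

IsTermUpTo : (ℕ → ℕ) → ℕ → ℕ → Set
IsTermUpTo n j a = ∃ λ i → (1 ≤ i) × (i ≤ j) × (a ≡ n i)

IsTermUpTo-suc : ∀ {n j a} → IsTermUpTo n j a → IsTermUpTo n (suc j) a
IsTermUpTo-suc (i , 1≤i , i≤j , a≡nᵢ) = i , 1≤i , m≤n⇒m≤1+n i≤j , a≡nᵢ

-- Representable n j k is SubsetSum n j (k * j).
SubsetSum : (ℕ → ℕ) → ℕ → ℕ → Set
SubsetSum n j t = Σ (List ℕ) λ as → Unique as × All (IsTermUpTo n j) as × (t ≡ sum as)

SubsetSum-suc : ∀ {n j t} → SubsetSum n j t → SubsetSum n (suc j) t
SubsetSum-suc (as , unique , terms , t≡) = as , unique , All.map IsTermUpTo-suc terms , t≡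

StrictlyIncreasing : (ℕ → ℕ) → Set
StrictlyIncreasing n = ∀ i → 1 ≤ i → n i < n (suc i)

BrownCondition : (ℕ → ℕ) → Set
BrownCondition n = ∀ j → n (suc j) ≤ 1 + partialSum n j

StrictlyIncreasing⇒< : ∀ {n} → StrictlyIncreasing n →
  ∀ {i} j → 1 ≤ i → i ≤ j → n i < n (suc j)
StrictlyIncreasing⇒< inc zero (s≤s _) ()
StrictlyIncreasing⇒< inc (suc j) 1≤i i≤1+j with m≤n⇒m<n∨m≡n i≤1+j
... | inj₂ refl      = inc (suc j) 1≤i
... | inj₁ (s≤s i≤j) = <-trans (StrictlyIncreasing⇒< inc j 1≤i i≤j) (inc (suc j) (s≤s z≤n))

SubsetSum-add-next : ∀ {n j s} → StrictlyIncreasing n →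
  SubsetSum n j s → SubsetSum n (suc j) (n (suc j) + s)
SubsetSum-add-next {n} {j} inc (as , unique , terms , s≡) =
  n (suc j) ∷ as ,
  All.map (λ (i , 1≤i , i≤j , a≡nᵢ) nⱼ₊₁≡a →
             <-irrefl (trans (sym a≡nᵢ) (sym nⱼ₊₁≡a)) (StrictlyIncreasing⇒< inc j 1≤i i≤j))
          terms ∷ unique ,
  (suc j , s≤s z≤n , ≤-refl , refl) ∷ All.map IsTermUpTo-suc terms ,
  cong (n (suc j) +_) s≡

complete : ∀ {n} → StrictlyIncreasing n → BrownCondition n →
  ∀ j t → t ≤ partialSum n j → SubsetSum n j t
complete inc brown zero t t≤0 = [] , [] , [] , n≤0⇒n≡0 t≤0
complete {n} inc brown (suc j) t t≤ with t ≤? partialSum n j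
... | yes t≤sum = SubsetSum-suc (complete inc brown j t t≤sum)
... | no t≰sum  = subst (SubsetSum n (suc j)) (m+[n∸m]≡n nⱼ₊₁≤t)
                        (SubsetSum-add-next inc (complete inc brown j (t ∸ n (suc j)) rest≤))
  where
  nⱼ₊₁≤t : n (suc j) ≤ t
  nⱼ₊₁≤t = ≤-trans (brown j) (≰⇒> t≰sum)
  rest≤ : t ∸ n (suc j) ≤ partialSum n j
  rest≤ = m≤n+o⇒m∸n≤o t (n (suc j))
    (≤-trans t≤ (≤-reflexive (trans (sum-applyUpTo-suc (λ i → n (suc i)) j)
                                    (+-comm (partialSum n j) (n (suc j))))))

complete⇒semicomplete : ∀ {n} → (∀ i → 1 ≤ i → 0 < n i) → StrictlyIncreasing n →
  BrownCondition n → Semicomplete n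
complete⇒semicomplete {n} pos inc brown = pos , inc , representable
  where
  representable : ∀ j (j>2 : 2 < j) → ∀ k → 0 < k → k < floorG n j j>2 → Representable n j k
  representable j j>2 k _ k<⌊G⌋ = complete inc brown j (k * j)
    (≤-trans (*-monoˡ-≤ j (<⇒≤ k<⌊G⌋))
             (m/n*n≤m (partialSum n j) j {{>-nonZero (≤-trans (s≤s z≤n) j>2)}}))

-- The first summand m C 0 reduces to 1.
Cuts-pos : ∀ M i → 1 ≤ i → 0 < Cuts M i
Cuts-pos M (suc m) _ = m≤m+n 1 _

Cuts-monoˡ : ∀ M m → Cuts M (suc m) ≤ Cuts (suc M) (suc m)
Cuts-monoˡ M m = ≤-trans (m≤m+n (Cuts M (suc m)) (m C suc M))
                         (≤-reflexive (sym (sum-applyUpTo-suc (m C_) (suc M))))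

Cuts-1 : ∀ M → Cuts M 1 ≡ 1
Cuts-1 zero    = refl
Cuts-1 (suc M) = begin
  Cuts (suc M) 1      ≡⟨ sum-applyUpTo-suc (0 C_) (suc M) ⟩
  Cuts M 1 + 0        ≡⟨ +-identityʳ (Cuts M 1) ⟩
  Cuts M 1            ≡⟨ Cuts-1 M ⟩
  1                   ∎
  where open ≡-Reasoning

Cuts-pascal : ∀ M m → Cuts (suc M) (suc (suc m)) ≡ Cuts (suc M) (suc m) + Cuts M (suc m)
Cuts-pascal M m = cong suc (begin
  sum (applyUpTo (λ i → suc m C suc i) (suc M))
    ≡⟨ sum-applyUpTo-cong (λ i → sym (nCk+nC[k+1]≡[n+1]C[k+1] m i)) (suc M) ⟩
  sum (applyUpTo (λ i → m C i + m C suc i) (suc M))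
    ≡⟨ sum-applyUpTo-+ (m C_) (λ i → m C suc i) (suc M) ⟩
  Cuts M (suc m) + sum (applyUpTo (λ i → m C suc i) (suc M))
    ≡⟨ +-comm (Cuts M (suc m)) _ ⟩
  sum (applyUpTo (λ i → m C suc i) (suc M)) + Cuts M (suc m) ∎)
  where open ≡-Reasoning

Cuts-increasing : ∀ M → StrictlyIncreasing (Cuts (suc M))
Cuts-increasing M (suc m) _ = begin-strict
  Cuts (suc M) (suc m)                    <⟨ m<m+n _ (Cuts-pos M (suc m) (s≤s z≤n)) ⟩
  Cuts (suc M) (suc m) + Cuts M (suc m)   ≡⟨ Cuts-pascal M m ⟨
  Cuts (suc M) (suc (suc m))              ∎
  where open ≤-Reasoning

Cuts-brown : ∀ M → BrownCondition (Cuts M)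
Cuts-brown zero    j       = s≤s z≤n
Cuts-brown (suc M) zero    = ≤-reflexive (Cuts-1 (suc M))
Cuts-brown (suc M) (suc j) = begin
  Cuts (suc M) (suc (suc j))                   ≡⟨ Cuts-pascal M j ⟩
  Cuts (suc M) (suc j) + Cuts M (suc j)        ≤⟨ +-monoʳ-≤ (Cuts (suc M) (suc j)) (Cuts-monoˡ M j) ⟩
  Cuts (suc M) (suc j) + Cuts (suc M) (suc j)  ≤⟨ +-monoʳ-≤ (Cuts (suc M) (suc j)) (Cuts-brown (suc M) j) ⟩
  Cuts (suc M) (suc j) + (1 + Sⱼ)              ≡⟨ +-comm (Cuts (suc M) (suc j)) _ ⟩
  1 + (Sⱼ + Cuts (suc M) (suc j))              ≡⟨ cong suc (sum-applyUpTo-suc (λ i → Cuts (suc M) (suc i)) j) ⟨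
  1 + partialSum (Cuts (suc M)) (suc j)        ∎
  where
  open ≤-Reasoning
  Sⱼ : ℕ
  Sⱼ = partialSum (Cuts (suc M)) j

theorem2 : ∀ M → 1 ≤ M → M ≤ 4 → Semicomplete (Cuts M)
theorem2 (suc M) _ _ =
  complete⇒semicomplete (Cuts-pos (suc M)) (Cuts-increasing M) (Cuts-brown (suc M))
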